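{- For every integer $n\geq 0$ and any indeterminate $y$, \begin{align*} \sum_{k=0}^{n}(-1)^{n-k}\binom{n}{k}Q_{n,k}(y+1)^{k}&=\sum_{k=0}^{n}\binom{n}{k}y^{k}I_{k},\\ \sum_{k=0}^{n}\binom{n}{k}Q_{n,k}\,y^{k} &= \sum_{k=0}^{n}(-1)^{n-k}\binom{n}{k}(y+1)^{k}I_{k},\\ \sum_{k=0}^{n}\binom{n}{k}Q_{n,k}\,y^{k} &= \sum_{k=0}^{\lfloor n/2\rfloor}\binom{n}{2k}(2k-1)!!\,y^{n-2k}(y+1)^{2k}. \end{align*}
   Context: An involution of a finite set is a permutation $\sigma$ with $\sigma^2=\mathrm{id}$. For $0\le k\le n$, $Q_{n,k}$ is the number of involutions of $[n+1]=\{1,\dots,n+1\}$ whose largest fixed point is $k+1$. $I_n$ is the number of involutions of $[n]$ ($I_0=1$). $(2k-1)!!=1\cdot3\cdots(2k-1)$ with $(-1)!!=1$. -}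

module Defs where

open import Level using (Level)
open import Data.Nat using (ℕ; zero; suc)
open import Data.Nat.Combinatorics using (_C_)
open import Data.Fin using (Fin; _<_; toℕ)
open import Data.Fin.Properties using (all?; any?; _≟_; _<?_)
import Data.Nat as ℕ
open import Data.Vec using (Vec; []; _∷_; lookup)
open import Data.List using (List; []; _∷_; [_]; map; concatMap; filter; length)
open import Data.Product using (_×_; Σ)
open import Relation.Binary.PropositionalEquality using (_≡_; _≢_)
open import Relation.Nullary using (Dec; ¬_)
open import Relation.Nullary.Decidable using (_×-dec_; ¬?; _→-dec_)
open import Relation.Unary using (Decidable)
open import Algebra.Bundles using (CommutativeRing)

-- Maps [m] → [m] are represented by their value tables Vec (Fin m) m
-- (the element i ∈ Fin m stands for i+1 ∈ {1,…,m}).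

allVecs : (m k : ℕ) → List (Vec (Fin m) k)
allVecs m zero    = [ [] ]
allVecs m (suc k) = concatMap (λ i → map (i ∷_) (allVecs m k)) (Data.List.allFin m)
  where import Data.List

allMaps : (m : ℕ) → List (Vec (Fin m) m)
allMaps m = allVecs m m

IsInvolution : {m : ℕ} → Vec (Fin m) m → Set
IsInvolution {m} σ = ∀ (i : Fin m) → lookup σ (lookup σ i) ≡ i

isInvolution? : {m : ℕ} → Decidable (IsInvolution {m})
isInvolution? σ = all? (λ i → lookup σ (lookup σ i) ≟ i)

LargestFixedPoint : {m : ℕ} → Vec (Fin m) m → Fin m → Set
LargestFixedPoint {m} σ j = (lookup σ j ≡ j) × (∀ (i : Fin m) → j < i → lookup σ i ≢ i)

largestFixedPoint? : {m : ℕ} (j : Fin m) → Decidable (λ σ → LargestFixedPoint {m} σ j)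
largestFixedPoint? j σ = (lookup σ j ≟ j) ×-dec all? (λ i → implies (j <? i) (¬? (lookup σ i ≟ i)))
  where
  implies : ∀ {p q} {P : Set p} {Q : Set q} → Dec P → Dec Q → Dec (P → Q)
  implies = _→-dec_

I : ℕ → ℕ
I m = length (filter isInvolution? (allMaps m))

-- the largest fixed point of σ : [m] → [m] is k+1 (k : ℕ; the 0-indexed
-- element j : Fin m with toℕ j ≡ k stands for k+1)
HasLargestFixedPoint : {m : ℕ} → Vec (Fin m) m → ℕ → Set
HasLargestFixedPoint {m} σ k = Σ (Fin m) (λ j → (toℕ j ≡ k) × LargestFixedPoint σ j)

hasLargestFixedPoint? : {m : ℕ} (k : ℕ) → Decidable (λ σ → HasLargestFixedPoint {m} σ k)
hasLargestFixedPoint? k σ = any? (λ j → (toℕ j ℕ.≟ k) ×-dec largestFixedPoint? j σ)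

-- Q n k : number of involutions of [n+1] whose largest fixed point is k+1
-- (meaningful for 0 ≤ k ≤ n)
Q : ℕ → ℕ → ℕ
Q n k = length (filter (λ σ → isInvolution? σ ×-dec hasLargestFixedPoint? k σ) (allMaps (suc n)))

-- (2k-1)!! with (-1)!! = 1
oddDoubleFactorial : ℕ → ℕ
oddDoubleFactorial zero    = 1
oddDoubleFactorial (suc k) = (suc (2 ℕ.* k)) ℕ.* oddDoubleFactorial k

module RingOps {c ℓ : Level} (R : CommutativeRing c ℓ) where
  open CommutativeRing R

  fromℕ : ℕ → Carrier
  fromℕ zero    = 0#
  fromℕ (suc n) = 1# + fromℕ n

  pow : Carrier → ℕ → Carrier
  pow x zero    = 1#
  pow x (suc n) = x * pow x n

  sumTo : ℕ → (ℕ → Carrier) → Carrier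
  sumTo zero    f = f 0
  sumTo (suc n) f = sumTo n f + f (suc n)

  sign : ℕ → Carrier
  sign e = pow (- 1#) e

module Submission where

-- Let pm(b) be the number of perfect matchings of [b] ((b-1)!! for even b,
-- 0 for odd b) and movingInvolutions a b the number of involutions of [a+b]
-- without fixed points among the last b points.
--
-- Counting: classifying the involutions that respect a pattern of free and
-- moved points by the partner of the first point gives a recurrence; for the
-- pattern "a free points, then b moved points" it is the recurrence defining
-- movingInvolutions. Hence I_m = movingInvolutions m 0, and deleting the fixed
-- point k+1 gives Q_{n,k} = movingInvolutions k (n-k).
--
-- ClosedForms (in any commutative ring): movingInvolutions a b = ∑_e C(a,e) pm(b+e),
-- so I_k = ∑_e C(k,e) pm(e) and Q_{n,k} = ∑_e C(k,e) pm(n-e). The binomial convolution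
--   ∑_k C(n,k) (∑_e C(k,e) g_e) z^k w^(n-k) = ∑_e C(n,e) g_e z^e (z+w)^(n-e)
-- turns each of the four sums in the theorem into ∑_e C(n,e) pm(e) u^e v^(n-e)
-- with {u, v} = {y, y+1}; the third identity keeps only the even e.

open import Defs
open import Level using (Level)
open import Data.Nat using (ℕ; _∸_; ⌊_/2⌋)
import Data.Nat as ℕ
open import Data.Nat.Combinatorics using (_C_)
open import Data.Product using (_×_; _,_)
open import Algebra.Bundles using (CommutativeRing)

module Counting where
  open import Data.Nat using (zero; suc; pred; _+_; _*_; _≤_; _<_; z≤n; s≤s; _≤?_)
  open import Data.Nat.Properties
    using (+-assoc; +-identityʳ; +-suc; suc-injective; m+n∸m≡n; m≤m+n; ≤⇒≯; ≰⇒>; ≤-reflexive; m+[n∸m]≡n; +-*-semiring)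
  open import Data.Fin using (Fin; zero; suc; toℕ; fromℕ<; punchIn)
  open import Data.Fin.Properties
    using (all?; _≟_; punchInᵢ≢i; punchIn-punchOut; punchIn-injective; 0≢1+n; toℕ<n; toℕ-injective; toℕ-fromℕ<)
  import Data.Fin.Properties as Fin
  open import Data.Vec using (Vec; []; _∷_; lookup; map; insertAt; removeAt)
  open import Data.Vec.Properties using (insertAt-lookup; insertAt-punchIn; lookup-map; lookup∘tabulate)
  import Data.Vec as Vec
  open import Data.List using (List; []; _∷_; _++_; filter; length; concatMap; tabulate)
  import Data.List as List
  open import Data.Product using (proj₁; proj₂)
  open import Data.Unit using (⊤; tt)
  open import Data.Empty using (⊥-elim)
  open import Function using (id)
  open import Relation.Binary.PropositionalEquality
    using (_≡_; _≢_; refl; sym; trans; cong; cong₂; subst; module ≡-Reasoning)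
  open import Relation.Nullary using (Dec; yes; no; ¬_)
  open import Relation.Nullary.Decidable using (_×-dec_; ¬?)
  open import Relation.Unary using (Decidable)
  open import Algebra.Properties.Semiring.Sum +-*-semiring
    using (sum; sum-syntax; sum-cong-≗; sum-remove; sum-replicate-zero)

  indicator : {P : Set} → Dec P → ℕ
  indicator (yes _) = 1
  indicator (no _)  = 0

  count : {A : Set} {P : A → Set} → Decidable P → List A → ℕ
  count P? []       = 0
  count P? (x ∷ xs) = indicator (P? x) + count P? xs

  length-filter : {A : Set} {P : A → Set} (P? : Decidable P) (xs : List A) →
    length (filter P? xs) ≡ count P? xs
  length-filter P? []       = refl
  length-filter P? (x ∷ xs) with P? x
  ... | yes _ = cong suc (length-filter P? xs)
  ... | no _  = length-filter P? xs

  count-cong : {A : Set} {P Q : A → Set} (P? : Decidable P) (Q? : Decidable Q) →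
    (∀ x → P x → Q x) → (∀ x → Q x → P x) → (xs : List A) → count P? xs ≡ count Q? xs
  count-cong P? Q? P⇒Q Q⇒P []       = refl
  count-cong P? Q? P⇒Q Q⇒P (x ∷ xs) with P? x | Q? x
  ... | yes _ | yes _ = cong suc (count-cong P? Q? P⇒Q Q⇒P xs)
  ... | no _  | no _  = count-cong P? Q? P⇒Q Q⇒P xs
  ... | yes p | no ¬q = ⊥-elim (¬q (P⇒Q x p))
  ... | no ¬p | yes q = ⊥-elim (¬p (Q⇒P x q))

  count-none : {A : Set} {P : A → Set} (P? : Decidable P) → (∀ x → ¬ P x) → (xs : List A) →
    count P? xs ≡ 0
  count-none P? ¬P []       = refl
  count-none P? ¬P (x ∷ xs) with P? x
  ... | yes p = ⊥-elim (¬P x p)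
  ... | no _  = count-none P? ¬P xs

  count-++ : {A : Set} {P : A → Set} (P? : Decidable P) (xs ys : List A) →
    count P? (xs ++ ys) ≡ count P? xs + count P? ys
  count-++ P? []       ys = refl
  count-++ P? (x ∷ xs) ys =
    trans (cong (indicator (P? x) +_) (count-++ P? xs ys)) (sym (+-assoc (indicator (P? x)) _ _))

  count-map : {A B : Set} {P : B → Set} (P? : Decidable P) (f : A → B) (xs : List A) →
    count P? (List.map f xs) ≡ count (λ x → P? (f x)) xs
  count-map P? f []       = refl
  count-map P? f (x ∷ xs) = cong (indicator (P? (f x)) +_) (count-map P? f xs)

  count-const× : {A D : Set} {P : A → Set} (D? : Dec D) (P? : Decidable P) (xs : List A) →
    count (λ x → D? ×-dec P? x) xs ≡ indicator D? * count P? xs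
  count-const× (yes d) P? xs =
    trans (count-cong _ P? (λ _ → proj₂) (λ _ p → d , p) xs) (sym (+-identityʳ _))
  count-const× (no ¬d) P? xs = count-none _ (λ _ p → ¬d (proj₁ p)) xs

  sum-single : ∀ m (c : Fin (suc m)) (t : Fin (suc m) → ℕ) → (∀ i → i ≢ c → t i ≡ 0) →
    sum t ≡ t c
  sum-single m c t vanish = begin
    sum t                                  ≡⟨ sum-remove {i = c} t ⟩
    t c + sum (λ i → t (punchIn c i))     ≡⟨ cong (t c +_) (sum-cong-≗ (λ i → vanish _ (punchInᵢ≢i c i))) ⟩
    t c + sum {m} (λ _ → 0)               ≡⟨ cong (t c +_) (sum-replicate-zero m) ⟩
    t c + 0                                ≡⟨ +-identityʳ (t c) ⟩
    t c                                    ∎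
    where open ≡-Reasoning

  sum-twoValued : ∀ n a (t : Fin n → ℕ) x y → a ≤ n →
    (∀ j → toℕ j < a → t j ≡ x) → (∀ j → a ≤ toℕ j → t j ≡ y) →
    sum t ≡ a * x + (n ∸ a) * y
  sum-twoValued zero    zero    t x y _ _ _ = refl
  sum-twoValued (suc n) zero    t x y _ _ isY =
    cong₂ _+_ (isY zero z≤n) (sum-twoValued n zero (λ j → t (suc j)) x y z≤n (λ _ ()) (λ j _ → isY (suc j) z≤n))
  sum-twoValued (suc n) (suc a) t x y (s≤s a≤n) isX isY =
    trans (cong₂ _+_ (isX zero (s≤s z≤n))
                     (sum-twoValued n a (λ j → t (suc j)) x y a≤n (λ j p → isX (suc j) (s≤s p)) (λ j p → isY (suc j) (s≤s p))))
          (sym (+-assoc x (a * x) _))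

  count-allVecs-head : ∀ m k {P : Vec (Fin m) (suc k) → Set} (P? : Decidable P) →
    count P? (allVecs m (suc k)) ≡ ∑[ i < m ] count (λ v → P? (i ∷ v)) (allVecs m k)
  count-allVecs-head m k P? = byFirstEntry id
    where
    byFirstEntry : ∀ {n} (f : Fin n → Fin m) →
      count P? (concatMap (λ i → List.map (i ∷_) (allVecs m k)) (tabulate f))
        ≡ ∑[ t < n ] count (λ v → P? (f t ∷ v)) (allVecs m k)
    byFirstEntry {zero}  f = refl
    byFirstEntry {suc n} f =
      trans (count-++ P? (List.map (f zero ∷_) (allVecs m k)) _)
            (cong₂ _+_ (count-map P? (f zero ∷_) (allVecs m k)) (byFirstEntry (λ t → f (suc t))))

  count-avoiding : ∀ m k (c : Fin (suc m)) {P : Vec (Fin (suc m)) k → Set} (P? : Decidable P) →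
    (∀ v → P v → ∀ i → lookup v i ≢ c) →
    count P? (allVecs (suc m) k) ≡ count (λ v → P? (map (punchIn c) v)) (allVecs m k)
  count-avoiding m zero    c P? avoids = refl
  count-avoiding m (suc k) c P? avoids = begin
    count P? (allVecs (suc m) (suc k))
      ≡⟨ count-allVecs-head (suc m) k P? ⟩
    ∑[ i < suc m ] headed i
      ≡⟨ sum-remove {i = c} headed ⟩
    headed c + ∑[ i < m ] headed (punchIn c i)
      ≡⟨ cong₂ _+_ (count-none (λ v → P? (c ∷ v)) (λ v p → avoids (c ∷ v) p zero refl) (allVecs (suc m) k))
                   (sum-cong-≗ (λ i → count-avoiding m k c (λ v → P? (punchIn c i ∷ v))
                                                          (λ v p t → avoids _ p (suc t)))) ⟩
    ∑[ i < m ] count (λ v → P? (punchIn c i ∷ map (punchIn c) v)) (allVecs m k)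
      ≡⟨ count-allVecs-head m k (λ v → P? (map (punchIn c) v)) ⟨
    count (λ v → P? (map (punchIn c) v)) (allVecs m (suc k))
      ∎
    where
    open ≡-Reasoning
    headed : Fin (suc m) → ℕ
    headed i = count (λ v → P? (i ∷ v)) (allVecs (suc m) k)

  count-fixing : ∀ n k (j : Fin (suc k)) (c : Fin n) {P : Vec (Fin n) (suc k) → Set} (P? : Decidable P) →
    (∀ v → P v → lookup v j ≡ c) →
    count P? (allVecs n (suc k)) ≡ count (λ v → P? (insertAt v j c)) (allVecs n k)
  count-fixing (suc n) k zero c P? fixes =
    trans (count-allVecs-head (suc n) k P?)
          (sum-single n c (λ i → count (λ v → P? (i ∷ v)) (allVecs (suc n) k))
            (λ i i≢c → count-none (λ v → P? (i ∷ v)) (λ v p → i≢c (fixes (i ∷ v) p)) (allVecs (suc n) k)))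
  count-fixing n (suc k) (suc j) c P? fixes =
    trans (count-allVecs-head n (suc k) P?)
          (trans (sum-cong-≗ (λ i → count-fixing n k j c (λ v → P? (i ∷ v)) (λ v p → fixes (i ∷ v) p)))
                 (sym (count-allVecs-head n k (λ v → P? (insertAt v (suc j) c)))))

  lookup-removeAt : ∀ {A : Set} {m} (xs : Vec A (suc m)) (j : Fin (suc m)) (t : Fin m) →
    lookup (removeAt xs j) t ≡ lookup xs (punchIn j t)
  lookup-removeAt (x ∷ xs)           zero    t       = refl
  lookup-removeAt (x ∷ xs@(_ ∷ _)) (suc j) zero    = refl
  lookup-removeAt (x ∷ xs@(_ ∷ _)) (suc j) (suc t) = lookup-removeAt xs j t

  punchIn-cases : ∀ {m} (j : Fin (suc m)) (P : Fin (suc m) → Set) →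
    P j → (∀ t → P (punchIn j t)) → ∀ i → P i
  punchIn-cases j P atJ elsewhere i with i ≟ j
  ... | yes refl = atJ
  ... | no i≢j   = subst P (punchIn-punchOut (λ j≡i → i≢j (sym j≡i))) (elsewhere _)

  -- A status constrains the value of an involution at one point:
  -- a moved point must not be fixed.
  data Status : Set where
    free moved : Status

  isFree? : (s : Status) → Dec (s ≡ free)
  isFree? free  = yes refl
  isFree? moved = no (λ ())

  Respects : Status → {m : ℕ} → Fin m → Fin m → Set
  Respects free  v i = ⊤
  Respects moved v i = v ≢ i

  respects? : (s : Status) {m : ℕ} (v i : Fin m) → Dec (Respects s v i)
  respects? free  v i = yes tt
  respects? moved v i = ¬? (v ≟ i)

  respects-unfixed : ∀ s {m} {v i : Fin m} → v ≢ i → Respects s v i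
  respects-unfixed free  _   = tt
  respects-unfixed moved v≢i = v≢i

  respects-fixed : ∀ s {m} {i : Fin m} → Respects s i i → s ≡ free
  respects-fixed free  _   = refl
  respects-fixed moved i≢i = ⊥-elim (i≢i refl)

  GoodAt : {m : ℕ} → Vec Status m → Vec (Fin m) m → Fin m → Set
  GoodAt ps σ i = (lookup σ (lookup σ i) ≡ i) × Respects (lookup ps i) (lookup σ i) i

  Good : {m : ℕ} → Vec Status m → Vec (Fin m) m → Set
  Good ps σ = ∀ i → GoodAt ps σ i

  good? : {m : ℕ} (ps : Vec Status m) → Decidable (Good ps)
  good? ps σ = all? (λ i → (lookup σ (lookup σ i) ≟ i) ×-dec respects? (lookup ps i) (lookup σ i) i)

  Count : {m : ℕ} → Vec Status m → ℕ
  Count {m} ps = count (good? ps) (allMaps m)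

  partner : ∀ {m} {ps : Vec Status m} {σ : Vec (Fin m) m} → Good ps σ →
    ∀ {a b} → lookup σ a ≡ b → lookup σ b ≡ a
  partner {σ = σ} good {a} σa≡b = trans (cong (lookup σ) (sym σa≡b)) (proj₁ (good a))

  module Intertwined {m m'} (ι : Fin m' → Fin m) (ι-injective : ∀ {a b} → ι a ≡ ι b → a ≡ b)
    {σ : Vec (Fin m) m} {τ : Vec (Fin m') m'} (intertwines : ∀ t → lookup σ (ι t) ≡ ι (lookup τ t))
    {ps : Vec Status m} {ps' : Vec Status m'} (agrees : ∀ t → lookup ps' t ≡ lookup ps (ι t)) where

    twice : ∀ t → lookup σ (lookup σ (ι t)) ≡ ι (lookup τ (lookup τ t))
    twice t = trans (cong (lookup σ) (intertwines t)) (intertwines (lookup τ t))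

    respects-restrict : ∀ s t → Respects s (lookup σ (ι t)) (ι t) → Respects s (lookup τ t) t
    respects-restrict free  t _   = tt
    respects-restrict moved t r e = r (trans (intertwines t) (cong ι e))

    respects-extend : ∀ s t → Respects s (lookup τ t) t → Respects s (lookup σ (ι t)) (ι t)
    respects-extend free  t _   = tt
    respects-extend moved t r e = r (ι-injective (trans (sym (intertwines t)) e))

    restrict : ∀ t → GoodAt ps σ (ι t) → GoodAt ps' τ t
    restrict t (inv , r) =
      ι-injective (trans (sym (twice t)) inv) ,
      subst (λ s → Respects s (lookup τ t) t) (sym (agrees t)) (respects-restrict _ t r)

    extend : ∀ t → GoodAt ps' τ t → GoodAt ps σ (ι t)
    extend t (inv , r) =
      trans (twice t) (cong ι inv) ,
      respects-extend _ t (subst (λ s → Respects s (lookup τ t) t) (agrees t) r)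

  module FixedPointDeletion {m} (ps : Vec Status (suc m)) (j : Fin (suc m)) where

    withFixedPoint : Vec (Fin m) m → Vec (Fin (suc m)) (suc m)
    withFixedPoint τ = insertAt (map (punchIn j) τ) j j

    module Extension (τ : Vec (Fin m) m) = Intertwined (punchIn j) (punchIn-injective j _ _)
      {σ = withFixedPoint τ} {τ = τ}
      (λ t → trans (insertAt-punchIn _ j j t) (lookup-map t (punchIn j) τ))
      {ps = ps} {ps' = removeAt ps j} (lookup-removeAt ps j)

    fixesJ : ∀ τ → lookup (withFixedPoint τ) j ≡ j
    fixesJ τ = insertAt-lookup (map (punchIn j) τ) j j

    restrict : ∀ τ → Good ps (withFixedPoint τ) → (lookup ps j ≡ free) × Good (removeAt ps j) τ
    restrict τ good =
      respects-fixed _ (subst (λ v → Respects (lookup ps j) v j) (fixesJ τ) (proj₂ (good j))) ,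
      λ t → Extension.restrict τ t (good (punchIn j t))

    extend : ∀ τ → (lookup ps j ≡ free) × Good (removeAt ps j) τ → Good ps (withFixedPoint τ)
    extend τ (jFree , good) =
      punchIn-cases j (GoodAt ps (withFixedPoint τ))
        (subst (λ v → lookup (withFixedPoint τ) v ≡ j) (sym (fixesJ τ)) (fixesJ τ) ,
         subst (λ v → Respects (lookup ps j) v j) (sym (fixesJ τ))
               (subst (λ s → Respects s j j) (sym jFree) tt))
        (λ t → Extension.extend τ t (good t))

    avoidsJ : ∀ τ → Good ps (insertAt τ j j) → ∀ t → lookup τ t ≢ j
    avoidsJ τ good t τt≡j =
      punchInᵢ≢i j t (trans (sym (partner {ps = ps} {σ = insertAt τ j j} good σ[t]≡j)) (insertAt-lookup τ j j))
      where
      σ[t]≡j : lookup (insertAt τ j j) (punchIn j t) ≡ j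
      σ[t]≡j = trans (insertAt-punchIn τ j j t) τt≡j

    count-fixedPoint :
      count (λ τ → good? ps (insertAt τ j j)) (allVecs (suc m) m)
        ≡ indicator (isFree? (lookup ps j)) * Count (removeAt ps j)
    count-fixedPoint = begin
      count (λ τ → good? ps (insertAt τ j j)) (allVecs (suc m) m)
        ≡⟨ count-avoiding m m j (λ τ → good? ps (insertAt τ j j)) avoidsJ ⟩
      count (λ τ → good? ps (withFixedPoint τ)) (allVecs m m)
        ≡⟨ count-cong _ (λ τ → isFree? (lookup ps j) ×-dec good? (removeAt ps j) τ) restrict extend (allVecs m m) ⟩
      count (λ τ → isFree? (lookup ps j) ×-dec good? (removeAt ps j) τ) (allVecs m m)
        ≡⟨ count-const× (isFree? (lookup ps j)) (good? (removeAt ps j)) (allVecs m m) ⟩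
      indicator (isFree? (lookup ps j)) * Count (removeAt ps j)
        ∎
      where open ≡-Reasoning

  open FixedPointDeletion using (count-fixedPoint)

  -- Since paired points are not fixed, the statuses of both points are irrelevant.
  module Pairing {m} (s : Status) (ps : Vec Status (suc m)) (j : Fin (suc m)) where

    withPair : Vec (Fin m) m → Vec (Fin (suc (suc m))) (suc (suc m))
    withPair τ = suc j ∷ insertAt (map (punchIn zero) (map (punchIn j) τ)) j zero

    ι : Fin m → Fin (suc (suc m))
    ι t = suc (punchIn j t)

    module Extension (τ : Vec (Fin m) m) = Intertwined ι (λ e → punchIn-injective j _ _ (Fin.suc-injective e))
      {σ = withPair τ} {τ = τ}
      (λ t → trans (insertAt-punchIn _ j zero t)
             (trans (lookup-map t (punchIn zero) (map (punchIn j) τ)) (cong suc (lookup-map t (punchIn j) τ))))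
      {ps = s ∷ ps} {ps' = removeAt ps j} (lookup-removeAt ps j)

    partnerOfJ : (τ : Vec (Fin (suc (suc m))) m) (v : Fin (suc (suc m))) →
      lookup (suc j ∷ insertAt τ j v) (suc j) ≡ v
    partnerOfJ τ v = insertAt-lookup τ j v

    restrict : ∀ τ → Good (s ∷ ps) (withPair τ) → Good (removeAt ps j) τ
    restrict τ good t = Extension.restrict τ t (good (ι t))

    extend : ∀ τ → Good (removeAt ps j) τ → Good (s ∷ ps) (withPair τ)
    extend τ good zero    = partnerOfJ _ zero , respects-unfixed s (λ ())
    extend τ good (suc i) =
      punchIn-cases j (λ i → GoodAt (s ∷ ps) (withPair τ) (suc i))
        (subst (λ v → lookup (withPair τ) v ≡ suc j) (sym (partnerOfJ _ zero)) refl ,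
         subst (λ v → Respects (lookup ps j) v (suc j)) (sym (partnerOfJ _ zero)) (respects-unfixed _ (λ ())))
        (λ t → Extension.extend τ t (good t)) i

    avoidsZero : ∀ τ → Good (s ∷ ps) (suc j ∷ insertAt τ j zero) → ∀ t → lookup τ t ≢ zero
    avoidsZero τ good t τt≡0 =
      punchInᵢ≢i j t (sym (Fin.suc-injective (partner {ps = s ∷ ps} {σ = suc j ∷ insertAt τ j zero} good σιt≡0)))
      where
      σιt≡0 : lookup (suc j ∷ insertAt τ j zero) (ι t) ≡ zero
      σιt≡0 = trans (insertAt-punchIn τ j zero t) τt≡0

    avoidsJ : ∀ τ → Good (s ∷ ps) (suc j ∷ insertAt (map (punchIn zero) τ) j zero) → ∀ t → lookup τ t ≢ j
    avoidsJ τ good t τt≡j =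
      0≢1+n (trans (sym (partnerOfJ _ zero))
                   (partner {ps = s ∷ ps} {σ = suc j ∷ insertAt (map (punchIn zero) τ) j zero} good σιt≡1+j))
      where
      σιt≡1+j : lookup (suc j ∷ insertAt (map (punchIn zero) τ) j zero) (ι t) ≡ suc j
      σιt≡1+j = trans (insertAt-punchIn _ j zero t) (trans (lookup-map t (punchIn zero) τ) (cong suc τt≡j))

    count-pairing :
      count (λ τ → good? (s ∷ ps) (suc j ∷ τ)) (allVecs (suc (suc m)) (suc m)) ≡ Count (removeAt ps j)
    count-pairing = begin
      count (λ τ → good? (s ∷ ps) (suc j ∷ τ)) (allVecs (suc (suc m)) (suc m))
        ≡⟨ count-fixing (suc (suc m)) m j zero _ (λ τ good → partner {ps = s ∷ ps} {σ = suc j ∷ τ} good refl) ⟩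
      count (λ τ → good? (s ∷ ps) (suc j ∷ insertAt τ j zero)) (allVecs (suc (suc m)) m)
        ≡⟨ count-avoiding (suc m) m zero _ avoidsZero ⟩
      count (λ τ → good? (s ∷ ps) (suc j ∷ insertAt (map (punchIn zero) τ) j zero)) (allVecs (suc m) m)
        ≡⟨ count-avoiding m m j _ avoidsJ ⟩
      count (λ τ → good? (s ∷ ps) (withPair τ)) (allVecs m m)
        ≡⟨ count-cong _ (good? (removeAt ps j)) restrict extend (allVecs m m) ⟩
      Count (removeAt ps j)
        ∎
      where open ≡-Reasoning

  open Pairing using (count-pairing)

  deletions : {m : ℕ} → Vec Status m → ℕ
  deletions {zero}  []  = 0
  deletions {suc m} ps = ∑[ j < suc m ] Count (removeAt ps j)

  -- Classify involutions by the image of the first point: either it is fixed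
  -- (allowed only if it is free), or it is paired with some other point.
  count-recurrence : ∀ {m} (s : Status) (ps : Vec Status m) →
    Count (s ∷ ps) ≡ indicator (isFree? s) * Count ps + deletions ps
  count-recurrence {m} s ps =
    trans (count-allVecs-head (suc m) m (good? (s ∷ ps)))
          (cong₂ _+_ (count-fixedPoint (s ∷ ps) zero) (pairings m ps))
    where
    pairings : ∀ m (ps : Vec Status m) →
      ∑[ j < m ] count (λ τ → good? (s ∷ ps) (suc j ∷ τ)) (allVecs (suc m) m) ≡ deletions ps
    pairings zero    []  = refl
    pairings (suc m) ps = sum-cong-≗ (count-pairing s ps)

  -- The number of perfect matchings (fixed-point-free involutions) of [b]:
  -- (b-1)!! for even b and 0 for odd b.
  perfectMatchings : ℕ → ℕ
  perfectMatchings zero          = 1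
  perfectMatchings (suc zero)    = 0
  perfectMatchings (suc (suc b)) = suc b * perfectMatchings b

  -- The partner of the first point is one of the other b points.
  perfectMatchings-suc : ∀ b → perfectMatchings (suc b) ≡ b * perfectMatchings (pred b)
  perfectMatchings-suc zero    = refl
  perfectMatchings-suc (suc b) = refl

  -- movingInvolutions a b: the number of involutions of [a+b] without fixed
  -- points among the last b points, defined by the recurrence that
  -- count-recurrence yields for such patterns (for a = 0 the middle term vanishes).
  movingInvolutions : ℕ → ℕ → ℕ
  movingInvolutions zero          b = perfectMatchings b
  movingInvolutions (suc zero)    b = movingInvolutions zero b + b * movingInvolutions zero (pred b)
  movingInvolutions (suc (suc a)) b =
    movingInvolutions (suc a) b + (suc a * movingInvolutions a b + b * movingInvolutions (suc a) (pred b))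

  movingInvolutions-suc : ∀ a b → movingInvolutions (suc a) b
    ≡ movingInvolutions a b + (a * movingInvolutions (pred a) b + b * movingInvolutions a (pred b))
  movingInvolutions-suc zero    b = refl
  movingInvolutions-suc (suc a) b = refl

  shape : ℕ → ℕ → Status
  shape zero    x       = moved
  shape (suc a) zero    = free
  shape (suc a) (suc x) = shape a x

  HasShape : {m : ℕ} → ℕ → Vec Status m → Set
  HasShape a ps = ∀ i → lookup ps i ≡ shape a (toℕ i)

  shape-free : ∀ {a x} → x < a → shape a x ≡ free
  shape-free {suc a} {zero}  _         = refl
  shape-free {suc a} {suc x} (s≤s x<a) = shape-free x<a

  shape-moved : ∀ {a x} → a ≤ x → shape a x ≡ moved
  shape-moved {zero}  {x}     _         = refl
  shape-moved {suc a} {suc x} (s≤s a≤x) = shape-moved a≤x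

  shape-punchIn-free : ∀ {m} a (j : Fin (suc m)) (t : Fin m) → toℕ j < a →
    shape a (toℕ (punchIn j t)) ≡ shape (pred a) (toℕ t)
  shape-punchIn-free (suc a)       zero    t       _           = refl
  shape-punchIn-free (suc zero)    (suc j) t       (s≤s ())
  shape-punchIn-free (suc (suc a)) (suc j) zero    _           = refl
  shape-punchIn-free (suc (suc a)) (suc j) (suc t) (s≤s j<1+a) = shape-punchIn-free (suc a) j t j<1+a

  shape-punchIn-moved : ∀ {m} a (j : Fin (suc m)) (t : Fin m) → a ≤ toℕ j →
    shape a (toℕ (punchIn j t)) ≡ shape a (toℕ t)
  shape-punchIn-moved zero    j       t       _         = refl
  shape-punchIn-moved (suc a) (suc j) zero    _         = refl
  shape-punchIn-moved (suc a) (suc j) (suc t) (s≤s a≤j) = shape-punchIn-moved a j t a≤j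

  hasShape-tail : ∀ {m} a {s} {ps : Vec Status m} → HasShape a (s ∷ ps) → HasShape (pred a) ps
  hasShape-tail zero    shaped i = shaped (suc i)
  hasShape-tail (suc a) shaped i = shaped (suc i)

  hasShape-removeAt : ∀ {m} a (ps : Vec Status (suc m)) (j : Fin (suc m)) → HasShape a ps →
    (toℕ j < a → HasShape (pred a) (removeAt ps j)) × (a ≤ toℕ j → HasShape a (removeAt ps j))
  hasShape-removeAt a ps j shaped =
    (λ j<a t → trans (lookup-removeAt ps j t) (trans (shaped (punchIn j t)) (shape-punchIn-free a j t j<a))) ,
    (λ a≤j t → trans (lookup-removeAt ps j t) (trans (shaped (punchIn j t)) (shape-punchIn-moved a j t a≤j)))

  CountsShapes : ℕ → Set
  CountsShapes m = ∀ a b (ps : Vec Status m) → m ≡ a + b → HasShape a ps → Count ps ≡ movingInvolutions a b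

  deletions-shape : ∀ {m} a b (ps : Vec Status m) → m ≡ a + b → HasShape a ps → CountsShapes (pred m) →
    deletions ps ≡ a * movingInvolutions (pred a) b + b * movingInvolutions a (pred b)
  deletions-shape {zero}  zero zero [] _ _ _ = refl
  deletions-shape {suc m} a b ps 1+m≡a+b shaped counts =
    trans (sum-twoValued (suc m) a (λ j → Count (removeAt ps j)) _ _ a≤1+m (deleteFree a 1+m≡a+b shaped) (deleteMoved b 1+m≡a+b))
          (cong (λ n → a * movingInvolutions (pred a) b + n * movingInvolutions a (pred b))
                (trans (cong (_∸ a) 1+m≡a+b) (m+n∸m≡n a b)))
    where
    a≤1+m : a ≤ suc m
    a≤1+m = subst (a ≤_) (sym 1+m≡a+b) (m≤m+n a b)

    deleteFree : ∀ a → suc m ≡ a + b → HasShape a ps →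
      ∀ j → toℕ j < a → Count (removeAt ps j) ≡ movingInvolutions (pred a) b
    deleteFree (suc a) eq shaped j j<a =
      counts a b (removeAt ps j) (suc-injective eq) (proj₁ (hasShape-removeAt (suc a) ps j shaped) j<a)

    deleteMoved : ∀ b → suc m ≡ a + b →
      ∀ j → a ≤ toℕ j → Count (removeAt ps j) ≡ movingInvolutions a (pred b)
    deleteMoved zero    eq j a≤j = ⊥-elim (≤⇒≯ a≤j (subst (toℕ j <_) (trans eq (+-identityʳ a)) (toℕ<n j)))
    deleteMoved (suc b) eq j a≤j =
      counts a b (removeAt ps j) (suc-injective (trans eq (+-suc a b))) (proj₂ (hasShape-removeAt a ps j shaped) a≤j)

  -- Induction on the length, peeling off the first point with count-recurrence.
  -- counts-shorter supplies the hypothesis of deletions-shape.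
  count-shape : ∀ m → CountsShapes m
  counts-shorter : ∀ m → CountsShapes (pred m)

  counts-shorter zero    = count-shape zero
  counts-shorter (suc m) = count-shape m

  count-shape zero    zero    zero    [] _ _ = refl
  count-shape (suc m) zero    (suc b) (s ∷ ps) 1+m≡1+b shaped =
    trans (count-recurrence s ps)
    (trans (cong (λ s → indicator (isFree? s) * Count ps + deletions ps) (shaped zero))
    (trans (deletions-shape zero b ps (suc-injective 1+m≡1+b) (hasShape-tail zero shaped) (counts-shorter m))
           (sym (perfectMatchings-suc b))))
  count-shape (suc m) (suc a) b       (s ∷ ps) 1+m≡a+b shaped =
    trans (count-recurrence s ps)
    (trans (cong (λ s → indicator (isFree? s) * Count ps + deletions ps) (shaped zero))
    (trans (cong₂ _+_ (trans (+-identityʳ (Count ps)) (count-shape m a b ps m≡a+b (hasShape-tail (suc a) shaped)))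
                      (deletions-shape a b ps m≡a+b (hasShape-tail (suc a) shaped) (counts-shorter m)))
           (sym (movingInvolutions-suc a b))))
    where
    m≡a+b : m ≡ a + b
    m≡a+b = suc-injective 1+m≡a+b

  shapePattern : (a m : ℕ) → Vec Status m
  shapePattern a m = Vec.tabulate (λ i → shape a (toℕ i))

  shapePattern-hasShape : ∀ a m → HasShape a (shapePattern a m)
  shapePattern-hasShape a m = lookup∘tabulate (λ i → shape a (toℕ i))

  respects-shape : ∀ {m} a (i v : Fin m) → (a ≤ toℕ i → v ≢ i) → Respects (shape a (toℕ i)) v i
  respects-shape a i v unfixed with a ≤? toℕ i
  ... | yes a≤i = subst (λ s → Respects s v i) (sym (shape-moved a≤i)) (unfixed a≤i)
  ... | no  a≰i = subst (λ s → Respects s v i) (sym (shape-free (≰⇒> a≰i))) tt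

  I≡movingInvolutions : ∀ m → I m ≡ movingInvolutions m 0
  I≡movingInvolutions m =
    trans (length-filter isInvolution? (allMaps m))
    (trans (count-cong isInvolution? (good? ps) toGood (λ σ good i → proj₁ (good i)) (allMaps m))
           (count-shape m m 0 ps (sym (+-identityʳ m)) (shapePattern-hasShape m m)))
    where
    ps = shapePattern m m
    toGood : ∀ σ → IsInvolution σ → Good ps σ
    toGood σ inv i =
      inv i ,
      subst (λ s → Respects s (lookup σ i) i) (sym (shapePattern-hasShape m m i))
            (respects-shape m i (lookup σ i) (λ m≤i → ⊥-elim (≤⇒≯ m≤i (toℕ<n i))))

  -- An involution of [n+1] has largest fixed point k+1 iff it fixes k+1 and
  -- respects the pattern of shape k+1.
  module LargestFixedPoint (n k : ℕ) (k≤n : k ≤ n) where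

    ps : Vec Status (suc n)
    ps = shapePattern (suc k) (suc n)

    j : Fin (suc n)
    j = fromℕ< (s≤s k≤n)

    toℕj≡k : toℕ j ≡ k
    toℕj≡k = toℕ-fromℕ< (s≤s k≤n)

    toGood : ∀ σ → IsInvolution σ × HasLargestFixedPoint σ k → Good ps σ × (lookup σ j ≡ j)
    toGood σ (inv , j' , toℕj'≡k , σj'≡j' , beyondUnfixed) =
      (λ i → inv i ,
             subst (λ s → Respects s (lookup σ i) i) (sym (shapePattern-hasShape (suc k) (suc n) i))
                   (respects-shape (suc k) i (lookup σ i)
                      (λ k<i → beyondUnfixed i (subst (_< toℕ i) (sym toℕj'≡k) k<i)))) ,
      subst (λ x → lookup σ x ≡ x) j'≡j σj'≡j'
      where
      j'≡j : j' ≡ j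
      j'≡j = toℕ-injective (trans toℕj'≡k (sym toℕj≡k))

    fromGood : ∀ σ → Good ps σ × (lookup σ j ≡ j) → IsInvolution σ × HasLargestFixedPoint σ k
    fromGood σ (good , σj≡j) =
      (λ i → proj₁ (good i)) ,
      j , toℕj≡k , σj≡j ,
      λ i j<i → subst (λ s → Respects s (lookup σ i) i)
                      (trans (shapePattern-hasShape (suc k) (suc n) i) (shape-moved (subst (_< toℕ i) toℕj≡k j<i)))
                      (proj₂ (good i))

    Q≡Count : Q n k ≡ Count (removeAt ps j)
    Q≡Count = begin
      Q n k
        ≡⟨ length-filter _ (allMaps (suc n)) ⟩
      count (λ σ → isInvolution? σ ×-dec hasLargestFixedPoint? k σ) (allMaps (suc n))
        ≡⟨ count-cong _ (λ σ → good? ps σ ×-dec (lookup σ j ≟ j)) toGood fromGood (allMaps (suc n)) ⟩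
      count (λ σ → good? ps σ ×-dec (lookup σ j ≟ j)) (allMaps (suc n))
        ≡⟨ count-fixing (suc n) n j j _ (λ σ → proj₂) ⟩
      count (λ τ → good? ps (insertAt τ j j) ×-dec (lookup (insertAt τ j j) j ≟ j)) (allVecs (suc n) n)
        ≡⟨ count-cong _ (λ τ → good? ps (insertAt τ j j))
                      (λ τ → proj₁) (λ τ good → good , insertAt-lookup τ j j) (allVecs (suc n) n) ⟩
      count (λ τ → good? ps (insertAt τ j j)) (allVecs (suc n) n)
        ≡⟨ count-fixedPoint ps j ⟩
      indicator (isFree? (lookup ps j)) * Count (removeAt ps j)
        ≡⟨ cong (λ s → indicator (isFree? s) * Count (removeAt ps j)) jFree ⟩
      1 * Count (removeAt ps j)
        ≡⟨ +-identityʳ _ ⟩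
      Count (removeAt ps j)
        ∎
      where
      open ≡-Reasoning
      jFree : lookup ps j ≡ free
      jFree = trans (shapePattern-hasShape (suc k) (suc n) j) (shape-free (s≤s (≤-reflexive toℕj≡k)))

    Q≡movingInvolutions : Q n k ≡ movingInvolutions k (n ∸ k)
    Q≡movingInvolutions =
      trans Q≡Count
            (count-shape n k (n ∸ k) (removeAt ps j) (sym (m+[n∸m]≡n k≤n))
                         (proj₁ (hasShape-removeAt (suc k) ps j (shapePattern-hasShape (suc k) (suc n)))
                                (s≤s (≤-reflexive toℕj≡k))))

  open LargestFixedPoint public using (Q≡movingInvolutions)

module Arithmetic where
  open import Data.Nat using (zero; suc; _+_; _*_; z≤n; s≤s)
  open import Data.Nat.Properties using (+-suc; *-zeroʳ)
  open import Data.Nat.Combinatorics using (nCk+nC[k+1]≡[n+1]C[k+1]; nC1≡n; k>n⇒nCk≡0)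
  open import Data.Sum using (_⊎_; inj₁; inj₂)
  open import Relation.Binary.PropositionalEquality using (_≡_; refl; sym; trans; cong; cong₂; module ≡-Reasoning)
  open import Data.Nat.Solver using (module +-*-Solver)
  open Counting using (perfectMatchings)
  open +-*-Solver

  C-absorption : ∀ a k → (suc a C suc k) * suc k ≡ suc a * (a C k)
  C-absorption zero    zero    = refl
  C-absorption zero    (suc k) rewrite k>n⇒nCk≡0 {1} {suc (suc k)} (s≤s (s≤s z≤n)) | k>n⇒nCk≡0 {0} {suc k} (s≤s z≤n) = refl
  C-absorption (suc a) zero    rewrite nC1≡n (suc (suc a)) = refl
  C-absorption (suc a) (suc k) = begin
    (suc (suc a) C suc (suc k)) * suc (suc k)
      ≡⟨ cong (_* suc (suc k)) (sym (nCk+nC[k+1]≡[n+1]C[k+1] (suc a) (suc k))) ⟩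
    (X + Y) * suc (suc k)
      ≡⟨ solve 3 (λ X Y k → (X :+ Y) :* (con 2 :+ k) := X :* (con 1 :+ k) :+ X :+ Y :* (con 2 :+ k)) refl X Y k ⟩
    X * suc k + X + Y * suc (suc k)
      ≡⟨ cong₂ (λ u v → u + X + v) (C-absorption a k) (C-absorption a (suc k)) ⟩
    suc a * (a C k) + X + suc a * (a C suc k)
      ≡⟨ solve 4 (λ a Z X W → (con 1 :+ a) :* Z :+ X :+ (con 1 :+ a) :* W := (con 1 :+ a) :* (Z :+ W) :+ X)
                 refl a (a C k) X (a C suc k) ⟩
    suc a * ((a C k) + (a C suc k)) + X
      ≡⟨ cong (λ u → suc a * u + X) (nCk+nC[k+1]≡[n+1]C[k+1] a k) ⟩
    suc a * X + X
      ≡⟨ solve 2 (λ a X → (con 1 :+ a) :* X :+ X := (con 2 :+ a) :* X) refl a X ⟩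
    suc (suc a) * X
      ∎
    where
    open ≡-Reasoning
    X = suc a C suc k
    Y = suc a C suc (suc k)

  double-suc : ∀ q → 2 * suc q ≡ suc (suc (2 * q))
  double-suc q = cong suc (+-suc q (q + 0))

  parity : ∀ n → (n ≡ 2 * ⌊ n /2⌋) ⊎ (n ≡ suc (2 * ⌊ n /2⌋))
  parity zero          = inj₁ refl
  parity (suc zero)    = inj₂ refl
  parity (suc (suc n)) with parity n
  ... | inj₁ even = inj₁ (trans (cong (λ x → suc (suc x)) even) (sym (double-suc ⌊ n /2⌋)))
  ... | inj₂ odd  = inj₂ (trans (cong (λ x → suc (suc x)) odd) (cong suc (sym (double-suc ⌊ n /2⌋))))

  perfectMatchings-odd : ∀ j → perfectMatchings (suc (2 * j)) ≡ 0
  perfectMatchings-odd zero    = refl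
  perfectMatchings-odd (suc j) =
    trans (cong (λ x → perfectMatchings (suc x)) (double-suc j))
          (trans (cong (suc (suc (2 * j)) *_) (perfectMatchings-odd j)) (*-zeroʳ (suc (suc (2 * j)))))

  perfectMatchings-even : ∀ j → perfectMatchings (2 * j) ≡ oddDoubleFactorial j
  perfectMatchings-even zero    = refl
  perfectMatchings-even (suc j) =
    trans (cong perfectMatchings (double-suc j)) (cong (suc (2 * j) *_) (perfectMatchings-even j))

module ClosedForms {c ℓ : Level} (R : CommutativeRing c ℓ) where
  open import Data.Nat using (zero; suc; pred; z≤n)
  import Data.Nat.Properties as ℕₚ
  open import Data.Nat.Combinatorics using (nCk+nC[k+1]≡[n+1]C[k+1]; nCk≡nC[n∸k]; k>n⇒nCk≡0)
  open import Data.Sum using (inj₁; inj₂)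
  import Relation.Binary.PropositionalEquality as ≡
  open ≡ using (_≡_)
  open CommutativeRing R
  open RingOps R
  open import Relation.Binary.Reasoning.Setoid setoid
  open import Algebra.Solver.Ring.NaturalCoefficients.Default commutativeSemiring
  open Arithmetic
  open Counting
    using (perfectMatchings; perfectMatchings-suc; movingInvolutions; movingInvolutions-suc;
           I≡movingInvolutions; Q≡movingInvolutions)

  fromℕ-+ : ∀ a b → fromℕ (a ℕ.+ b) ≈ fromℕ a + fromℕ b
  fromℕ-+ zero    b = sym (+-identityˡ _)
  fromℕ-+ (suc a) b = trans (+-congˡ (fromℕ-+ a b)) (sym (+-assoc _ _ _))

  fromℕ-* : ∀ a b → fromℕ (a ℕ.* b) ≈ fromℕ a * fromℕ b
  fromℕ-* zero    b = sym (zeroˡ _)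
  fromℕ-* (suc a) b =
    trans (fromℕ-+ b (a ℕ.* b))
    (trans (+-congˡ (fromℕ-* a b)) (solve 2 (λ A B → B :+ A :* B := (con 1 :+ A) :* B) refl (fromℕ a) (fromℕ b)))

  pow-cong : ∀ {x y} n → x ≈ y → pow x n ≈ pow y n
  pow-cong zero    _   = refl
  pow-cong (suc n) x≈y = *-cong x≈y (pow-cong n x≈y)

  pow-one : ∀ n → pow 1# n ≈ 1#
  pow-one zero    = refl
  pow-one (suc n) = trans (*-identityˡ _) (pow-one n)

  sumTo-cong : ∀ n {f g : ℕ → Carrier} → (∀ k → k ℕ.≤ n → f k ≈ g k) → sumTo n f ≈ sumTo n g
  sumTo-cong zero    f≈g = f≈g 0 z≤n
  sumTo-cong (suc n) f≈g = +-cong (sumTo-cong n (λ k k≤n → f≈g k (ℕₚ.m≤n⇒m≤1+n k≤n))) (f≈g (suc n) ℕₚ.≤-refl)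

  sumTo-+ : ∀ n (f g : ℕ → Carrier) → sumTo n (λ k → f k + g k) ≈ sumTo n f + sumTo n g
  sumTo-+ zero    f g = refl
  sumTo-+ (suc n) f g =
    trans (+-congʳ (sumTo-+ n f g))
          (solve 4 (λ a b c d → (a :+ b) :+ (c :+ d) := (a :+ c) :+ (b :+ d)) refl
                 (sumTo n f) (sumTo n g) (f (suc n)) (g (suc n)))

  sumTo-*ˡ : ∀ n a (f : ℕ → Carrier) → sumTo n (λ k → a * f k) ≈ a * sumTo n f
  sumTo-*ˡ zero    a f = refl
  sumTo-*ˡ (suc n) a f = trans (+-congʳ (sumTo-*ˡ n a f)) (sym (distribˡ a _ _))

  sumTo-shift : ∀ n (f : ℕ → Carrier) → sumTo (suc n) f ≈ f 0 + sumTo n (λ k → f (suc k))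
  sumTo-shift zero    f = refl
  sumTo-shift (suc n) f = trans (+-congʳ (sumTo-shift n f)) (+-assoc _ _ _)

  sumTo-reflect : ∀ n (f : ℕ → Carrier) → sumTo n f ≈ sumTo n (λ k → f (n ∸ k))
  sumTo-reflect zero    f = refl
  sumTo-reflect (suc n) f =
    trans (+-congʳ (sumTo-reflect n f)) (trans (+-comm _ _) (sym (sumTo-shift n (λ k → f (suc n ∸ k)))))

  sumTo-double : ∀ q (f : ℕ → Carrier) → (∀ k → f (suc (2 ℕ.* k)) ≈ 0#) →
    sumTo (2 ℕ.* q) f ≈ sumTo q (λ k → f (2 ℕ.* k))
  sumTo-double zero    f oddVanish = refl
  sumTo-double (suc q) f oddVanish =
    trans (reflexive (≡.cong (λ m → sumTo m f) (double-suc q)))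
    (trans (+-congʳ (trans (+-congˡ (oddVanish q)) (+-identityʳ _)))
           (+-cong (sumTo-double q f oddVanish) (reflexive (≡.cong f (≡.sym (double-suc q))))))

  sumTo-evens : ∀ n (f : ℕ → Carrier) → (∀ k → f (suc (2 ℕ.* k)) ≈ 0#) →
    sumTo n f ≈ sumTo ⌊ n /2⌋ (λ k → f (2 ℕ.* k))
  sumTo-evens n f oddVanish with parity n
  ... | inj₁ even = trans (reflexive (≡.cong (λ m → sumTo m f) even)) (sumTo-double ⌊ n /2⌋ f oddVanish)
  ... | inj₂ odd  =
    trans (reflexive (≡.cong (λ m → sumTo m f) odd))
    (trans (+-congˡ (oddVanish ⌊ n /2⌋)) (trans (+-identityʳ _) (sumTo-double ⌊ n /2⌋ f oddVanish)))

  binomialSum : ℕ → (ℕ → Carrier) → Carrier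
  binomialSum n c = sumTo n (λ k → fromℕ (n C k) * c k)

  binomialForm : ℕ → (ℕ → Carrier) → Carrier → Carrier → Carrier
  binomialForm n c u v = sumTo n (λ k → fromℕ (n C k) * c k * pow u k * pow v (n ∸ k))

  binomialForm-cong : ∀ n {c d : ℕ → Carrier} {u u' v v'} → (∀ k → k ℕ.≤ n → c k ≈ d k) → u ≈ u' → v ≈ v' →
    binomialForm n c u v ≈ binomialForm n d u' v'
  binomialForm-cong n c≈d u≈u' v≈v' =
    sumTo-cong n (λ k k≤n → *-cong (*-cong (*-congˡ (c≈d k k≤n)) (pow-cong k u≈u')) (pow-cong (n ∸ k) v≈v'))

  binomialForm-+ : ∀ n (c d : ℕ → Carrier) u v →
    binomialForm n (λ k → c k + d k) u v ≈ binomialForm n c u v + binomialForm n d u v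
  binomialForm-+ n c d u v =
    trans (sumTo-cong n (λ _ _ → solve 5 (λ a x y p q → a :* (x :+ y) :* p :* q := a :* x :* p :* q :+ a :* y :* p :* q) refl _ _ _ _ _))
          (sumTo-+ n _ _)

  binomialForm-one : ∀ n c → binomialForm n c 1# 1# ≈ binomialSum n c
  binomialForm-one n c =
    sumTo-cong n (λ k _ → trans (*-cong (*-congˡ (pow-one k)) (pow-one (n ∸ k))) (trans (*-identityʳ _) (*-identityʳ _)))

  binomialForm-reflect : ∀ n c u v → binomialForm n c u v ≈ binomialForm n (λ k → c (n ∸ k)) v u
  binomialForm-reflect n c u v =
    trans (sumTo-reflect n _) (sumTo-cong n (λ k k≤n →
      trans (*-cong (*-congʳ (*-congʳ (reflexive (≡.cong fromℕ (≡.sym (nCk≡nC[n∸k] k≤n))))))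
                    (reflexive (≡.cong (pow v) (ℕₚ.m∸[m∸n]≡n k≤n))))
            (solve 4 (λ a x p q → a :* x :* p :* q := a :* x :* q :* p) refl _ _ _ _)))

  C-pascal : ∀ n k → fromℕ (suc n C suc k) ≈ fromℕ (n C k) + fromℕ (n C suc k)
  C-pascal n k = trans (reflexive (≡.cong fromℕ (≡.sym (nCk+nC[k+1]≡[n+1]C[k+1] n k)))) (fromℕ-+ (n C k) (n C suc k))

  binomialForm-raiseV : ∀ n c u v →
    sumTo (suc n) (λ k → fromℕ (n C k) * c k * pow u k * pow v (suc n ∸ k)) ≈ v * binomialForm n c u v
  binomialForm-raiseV n c u v = begin
    sumTo n term + term (suc n)
      ≈⟨ +-congˡ (trans (*-congʳ (*-congʳ (trans (*-congʳ C[n,n+1]≈0) (zeroˡ _)))) (trans (*-congʳ (zeroˡ _)) (zeroˡ _))) ⟩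
    sumTo n term + 0#
      ≈⟨ +-identityʳ _ ⟩
    sumTo n term
      ≈⟨ sumTo-cong n (λ k k≤n → trans (*-congˡ (reflexive (≡.cong (pow v) (ℕₚ.+-∸-assoc 1 k≤n))))
                       (solve 5 (λ a x p w q → a :* x :* p :* (w :* q) := w :* (a :* x :* p :* q)) refl _ _ _ _ _)) ⟩
    sumTo n (λ k → v * (fromℕ (n C k) * c k * pow u k * pow v (n ∸ k)))
      ≈⟨ sumTo-*ˡ n v _ ⟩
    v * binomialForm n c u v
      ∎
    where
    term : ℕ → Carrier
    term k = fromℕ (n C k) * c k * pow u k * pow v (suc n ∸ k)
    C[n,n+1]≈0 : fromℕ (n C suc n) ≈ 0#
    C[n,n+1]≈0 = reflexive (≡.cong fromℕ (k>n⇒nCk≡0 {n} ℕₚ.≤-refl))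

  binomialForm-suc : ∀ n c u v →
    binomialForm (suc n) c u v ≈ v * binomialForm n c u v + u * binomialForm n (λ k → c (suc k)) u v
  binomialForm-suc n c u v = begin
    binomialForm (suc n) c u v
      ≈⟨ sumTo-shift n _ ⟩
    first + sumTo n (λ j → fromℕ (suc n C suc j) * c (suc j) * pow u (suc j) * pow v (n ∸ j))
      ≈⟨ +-congˡ (sumTo-cong n (λ j _ → trans (*-congʳ (*-congʳ (*-congʳ (C-pascal n j))))
                   (solve 5 (λ a b x p q → (a :+ b) :* x :* p :* q := a :* x :* p :* q :+ b :* x :* p :* q) refl _ _ _ _ _))) ⟩
    first + sumTo n (λ j → lower j + upper j)
      ≈⟨ +-congˡ (sumTo-+ n lower upper) ⟩
    first + (sumTo n lower + sumTo n upper)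
      ≈⟨ solve 3 (λ a b d → a :+ (b :+ d) := (a :+ d) :+ b) refl first (sumTo n lower) (sumTo n upper) ⟩
    (first + sumTo n upper) + sumTo n lower
      ≈⟨ +-cong (trans (sym (sumTo-shift n _)) (binomialForm-raiseV n c u v)) lowerSum ⟩
    v * binomialForm n c u v + u * binomialForm n (λ k → c (suc k)) u v
      ∎
    where
    first = fromℕ (suc n C 0) * c 0 * pow u 0 * pow v (suc n)
    lower upper : ℕ → Carrier
    lower j = fromℕ (n C j) * c (suc j) * pow u (suc j) * pow v (n ∸ j)
    upper j = fromℕ (n C suc j) * c (suc j) * pow u (suc j) * pow v (n ∸ j)
    lowerSum : sumTo n lower ≈ u * binomialForm n (λ k → c (suc k)) u v
    lowerSum = trans (sumTo-cong n (λ _ _ → solve 5 (λ a x w p q → a :* x :* (w :* p) :* q := w :* (a :* x :* p :* q)) refl _ _ _ _ _))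
                     (sumTo-*ˡ n u _)

  binomialSum-suc : ∀ n c → binomialSum (suc n) c ≈ binomialSum n c + binomialSum n (λ k → c (suc k))
  binomialSum-suc n c =
    trans (sym (binomialForm-one (suc n) c))
    (trans (binomialForm-suc n c 1# 1#)
           (+-cong (trans (*-identityˡ _) (binomialForm-one n c)) (trans (*-identityˡ _) (binomialForm-one n _))))

  binomialForm-convolution : ∀ n (g : ℕ → Carrier) z w →
    binomialForm n (λ k → binomialSum k g) z w ≈ binomialForm n g z (z + w)
  binomialForm-convolution zero    g z w = *-congʳ (*-congʳ (*-congˡ (trans (*-congʳ (+-identityʳ 1#)) (*-identityˡ (g 0)))))
  binomialForm-convolution (suc n) g z w = begin
    binomialForm (suc n) (λ k → binomialSum k g) z w
      ≈⟨ binomialForm-suc n _ z w ⟩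
    w * binomialForm n (λ k → binomialSum k g) z w + z * binomialForm n (λ k → binomialSum (suc k) g) z w
      ≈⟨ +-congˡ (*-congˡ (trans (binomialForm-cong n (λ k _ → binomialSum-suc k g) refl refl) (binomialForm-+ n _ _ z w))) ⟩
    w * binomialForm n (λ k → binomialSum k g) z w
      + z * (binomialForm n (λ k → binomialSum k g) z w + binomialForm n (λ k → binomialSum k (λ e → g (suc e))) z w)
      ≈⟨ +-cong (*-congˡ (binomialForm-convolution n g z w))
                (*-congˡ (+-cong (binomialForm-convolution n g z w) (binomialForm-convolution n (λ e → g (suc e)) z w))) ⟩
    w * X + z * (X + Y)
      ≈⟨ solve 4 (λ w z X Y → w :* X :+ z :* (X :+ Y) := (z :+ w) :* X :+ z :* Y) refl w z X Y ⟩
    (z + w) * X + z * Y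
      ≈⟨ binomialForm-suc n g z (z + w) ⟨
    binomialForm (suc n) g z (z + w)
      ∎
    where
    X = binomialForm n g z (z + w)
    Y = binomialForm n (λ e → g (suc e)) z (z + w)

  binomialSum-absorb : ∀ a (c : ℕ → Carrier) →
    binomialSum a (λ e → fromℕ e * c e) ≈ fromℕ a * binomialSum (pred a) (λ e → c (suc e))
  binomialSum-absorb zero    c = trans (*-congˡ (zeroˡ _)) (trans (zeroʳ _) (sym (zeroˡ _)))
  binomialSum-absorb (suc a) c = begin
    binomialSum (suc a) (λ e → fromℕ e * c e)
      ≈⟨ sumTo-shift a _ ⟩
    fromℕ (suc a C 0) * (0# * c 0) + sumTo a (λ e → fromℕ (suc a C suc e) * (fromℕ (suc e) * c (suc e)))
      ≈⟨ +-cong (trans (*-congˡ (zeroˡ _)) (zeroʳ _)) (sumTo-cong a (λ e _ → absorbTerm e)) ⟩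
    0# + sumTo a (λ e → fromℕ (suc a) * (fromℕ (a C e) * c (suc e)))
      ≈⟨ +-identityˡ _ ⟩
    sumTo a (λ e → fromℕ (suc a) * (fromℕ (a C e) * c (suc e)))
      ≈⟨ sumTo-*ˡ a _ _ ⟩
    fromℕ (suc a) * binomialSum a (λ e → c (suc e))
      ∎
    where
    absorbTerm : ∀ e → fromℕ (suc a C suc e) * (fromℕ (suc e) * c (suc e)) ≈ fromℕ (suc a) * (fromℕ (a C e) * c (suc e))
    absorbTerm e = begin
      fromℕ (suc a C suc e) * (fromℕ (suc e) * c (suc e))
        ≈⟨ trans (sym (*-assoc _ _ _)) (*-congʳ (sym (fromℕ-* (suc a C suc e) (suc e)))) ⟩
      fromℕ ((suc a C suc e) ℕ.* suc e) * c (suc e)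
        ≈⟨ *-congʳ (reflexive (≡.cong fromℕ (C-absorption a e))) ⟩
      fromℕ (suc a ℕ.* (a C e)) * c (suc e)
        ≈⟨ trans (*-congʳ (fromℕ-* (suc a) (a C e))) (*-assoc _ _ _) ⟩
      fromℕ (suc a) * (fromℕ (a C e) * c (suc e))
        ∎

  -- ∑_e C(a,e) pm(b+e), where pm = perfectMatchings: the involutions counted
  -- by movingInvolutions a b, classified by the number e of free points they move.
  matchingSum : ℕ → ℕ → Carrier
  matchingSum a b = binomialSum a (λ e → fromℕ (perfectMatchings (b ℕ.+ e)))

  matchingSum-suc : ∀ a b →
    matchingSum (suc a) b ≈ matchingSum a b + (fromℕ a * matchingSum (pred a) b + fromℕ b * matchingSum a (pred b))
  matchingSum-suc a b = begin
    matchingSum (suc a) b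
      ≈⟨ binomialSum-suc a _ ⟩
    matchingSum a b + binomialSum a (λ e → fromℕ (perfectMatchings (b ℕ.+ suc e)))
      ≈⟨ +-congˡ (sumTo-cong a (λ e _ → trans (*-congˡ (splitMatchings e)) (distribˡ _ _ _))) ⟩
    matchingSum a b + sumTo a (λ e → fromℕ (a C e) * (fromℕ e * H e) + fromℕ (a C e) * (fromℕ b * H e))
      ≈⟨ +-congˡ (sumTo-+ a _ _) ⟩
    matchingSum a b + (binomialSum a (λ e → fromℕ e * H e) + binomialSum a (λ e → fromℕ b * H e))
      ≈⟨ +-congˡ (+-cong (binomialSum-absorb a H)
                         (trans (sumTo-cong a (λ _ _ → solve 3 (λ x y z → x :* (y :* z) := y :* (x :* z)) refl _ _ _))
                                (sumTo-*ˡ a _ _))) ⟩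
    matchingSum a b + (fromℕ a * binomialSum (pred a) (λ e → H (suc e)) + fromℕ b * binomialSum a H)
      ≈⟨ +-congˡ (+-cong (*-congˡ (sumTo-cong (pred a) (λ e _ → *-congˡ (reflexive
                                    (≡.cong (λ x → fromℕ (perfectMatchings (pred x))) (ℕₚ.+-suc b e))))))
                         (lastPoint b)) ⟩
    matchingSum a b + (fromℕ a * matchingSum (pred a) b + fromℕ b * matchingSum a (pred b))
      ∎
    where
    H : ℕ → Carrier
    H e = fromℕ (perfectMatchings (pred (b ℕ.+ e)))
    -- the first of b + e + 1 points is matched with one of the b + e others
    splitMatchings : ∀ e → fromℕ (perfectMatchings (b ℕ.+ suc e)) ≈ fromℕ e * H e + fromℕ b * H e
    splitMatchings e = begin
      fromℕ (perfectMatchings (b ℕ.+ suc e))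
        ≈⟨ reflexive (≡.cong fromℕ (≡.trans (≡.cong perfectMatchings (ℕₚ.+-suc b e)) (perfectMatchings-suc (b ℕ.+ e)))) ⟩
      fromℕ ((b ℕ.+ e) ℕ.* perfectMatchings (pred (b ℕ.+ e)))
        ≈⟨ trans (fromℕ-* (b ℕ.+ e) _) (*-congʳ (fromℕ-+ b e)) ⟩
      (fromℕ b + fromℕ e) * H e
        ≈⟨ solve 3 (λ B E h → (B :+ E) :* h := E :* h :+ B :* h) refl _ _ _ ⟩
      fromℕ e * H e + fromℕ b * H e
        ∎
    lastPoint : ∀ b → fromℕ b * binomialSum a (λ e → fromℕ (perfectMatchings (pred (b ℕ.+ e))))
                      ≈ fromℕ b * matchingSum a (pred b)
    lastPoint zero    = trans (zeroˡ _) (sym (zeroˡ _))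
    lastPoint (suc b) = refl

  movingInvolutions-step : ∀ a b →
    fromℕ (movingInvolutions a b) ≈ matchingSum a b →
    fromℕ (movingInvolutions (pred a) b) ≈ matchingSum (pred a) b →
    fromℕ (movingInvolutions a (pred b)) ≈ matchingSum a (pred b) →
    fromℕ (movingInvolutions (suc a) b) ≈ matchingSum (suc a) b
  movingInvolutions-step a b same fewerFree fewerMoved = begin
    fromℕ (movingInvolutions (suc a) b)
      ≈⟨ reflexive (≡.cong fromℕ (movingInvolutions-suc a b)) ⟩
    fromℕ (movingInvolutions a b ℕ.+ (a ℕ.* movingInvolutions (pred a) b ℕ.+ b ℕ.* movingInvolutions a (pred b)))
      ≈⟨ trans (fromℕ-+ (movingInvolutions a b) _) (+-congˡ (trans (fromℕ-+ (a ℕ.* movingInvolutions (pred a) b) _)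
                                                              (+-cong (fromℕ-* a _) (fromℕ-* b _)))) ⟩
    fromℕ (movingInvolutions a b) + (fromℕ a * fromℕ (movingInvolutions (pred a) b) + fromℕ b * fromℕ (movingInvolutions a (pred b)))
      ≈⟨ +-cong same (+-cong (*-congˡ fewerFree) (*-congˡ fewerMoved)) ⟩
    matchingSum a b + (fromℕ a * matchingSum (pred a) b + fromℕ b * matchingSum a (pred b))
      ≈⟨ matchingSum-suc a b ⟨
    matchingSum (suc a) b
      ∎

  movingInvolutions-closed : ∀ a b → fromℕ (movingInvolutions a b) ≈ matchingSum a b
  movingInvolutions-closed zero b =
    sym (trans (*-congʳ (+-identityʳ 1#))
        (trans (*-identityˡ _) (reflexive (≡.cong (λ x → fromℕ (perfectMatchings x)) (ℕₚ.+-identityʳ b)))))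
  movingInvolutions-closed (suc zero) b =
    movingInvolutions-step 0 b (movingInvolutions-closed 0 b) (movingInvolutions-closed 0 b) (movingInvolutions-closed 0 (pred b))
  movingInvolutions-closed (suc (suc a)) b =
    movingInvolutions-step (suc a) b (movingInvolutions-closed (suc a) b) (movingInvolutions-closed a b)
                           (movingInvolutions-closed (suc a) (pred b))

  matchings : ℕ → Carrier
  matchings e = fromℕ (perfectMatchings e)

  -- I_k = ∑_e C(k,e) pm(e): choose the e points that are not fixed.
  I-closed : ∀ k → fromℕ (I k) ≈ binomialSum k matchings
  I-closed k = trans (reflexive (≡.cong fromℕ (I≡movingInvolutions k))) (movingInvolutions-closed k 0)

  Q-closed : ∀ n k → k ℕ.≤ n → fromℕ (Q n k) ≈ binomialSum k (λ e → matchings (n ∸ e))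
  Q-closed n k k≤n =
    trans (reflexive (≡.cong fromℕ (Q≡movingInvolutions n k k≤n)))
    (trans (movingInvolutions-closed k (n ∸ k))
    (trans (sumTo-reflect k _)
           (sumTo-cong k (λ e e≤k → *-cong (reflexive (≡.cong fromℕ (≡.sym (nCk≡nC[n∸k] e≤k))))
                                           (reflexive (≡.cong matchings (remaining e≤k)))))))
    where
    remaining : ∀ {e} → e ℕ.≤ k → (n ∸ k) ℕ.+ (k ∸ e) ≡ n ∸ e
    remaining {e} e≤k = ≡.trans (≡.sym (ℕₚ.+-∸-assoc (n ∸ k) e≤k)) (≡.cong (_∸ e) (ℕₚ.m∸n+n≡m k≤n))

  Q-transform : ∀ n z w → binomialForm n (λ k → fromℕ (Q n k)) z w ≈ binomialForm n matchings (z + w) z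
  Q-transform n z w =
    trans (binomialForm-cong n (λ k k≤n → Q-closed n k k≤n) refl refl)
    (trans (binomialForm-convolution n _ z w)
    (trans (binomialForm-reflect n _ z (z + w))
           (binomialForm-cong n (λ k k≤n → reflexive (≡.cong matchings (ℕₚ.m∸[m∸n]≡n k≤n))) refl refl)))

  I-transform : ∀ n z w → binomialForm n (λ k → fromℕ (I k)) z w ≈ binomialForm n matchings z (z + w)
  I-transform n z w = trans (binomialForm-cong n (λ k _ → I-closed k) refl refl) (binomialForm-convolution n _ z w)

  -- Only even numbers of points have perfect matchings.
  matchings-evens : ∀ n u v → binomialForm n matchings u v
    ≈ sumTo ⌊ n /2⌋ (λ k → fromℕ (n C (2 ℕ.* k)) * fromℕ (oddDoubleFactorial k) * pow v (n ∸ 2 ℕ.* k) * pow u (2 ℕ.* k))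
  matchings-evens n u v =
    trans (sumTo-evens n _ oddVanish)
          (sumTo-cong ⌊ n /2⌋ (λ k _ →
            trans (*-congʳ (*-congʳ (*-congˡ (reflexive (≡.cong fromℕ (perfectMatchings-even k))))))
                  (solve 4 (λ a x p q → a :* x :* p :* q := a :* x :* q :* p) refl _ _ _ _)))
    where
    oddVanish : ∀ j →
      fromℕ (n C suc (2 ℕ.* j)) * matchings (suc (2 ℕ.* j)) * pow u (suc (2 ℕ.* j)) * pow v (n ∸ suc (2 ℕ.* j)) ≈ 0#
    oddVanish j =
      trans (*-congʳ (*-congʳ (trans (*-congˡ (reflexive (≡.cong fromℕ (perfectMatchings-odd j)))) (zeroʳ _))))
            (trans (*-congʳ (zeroˡ _)) (zeroˡ _))

  module Sums (n : ℕ) (y : Carrier) where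

    -- the signed sums are binomial forms with v = -1 and u + v = y
    y+1-1 : (y + 1#) + - 1# ≈ y
    y+1-1 = trans (+-assoc _ _ _) (trans (+-congˡ (-‿inverseʳ 1#)) (+-identityʳ y))

    -- the unsigned sums are binomial forms with v = 1
    times-pow-one : ∀ k x → x ≈ x * pow 1# (n ∸ k)
    times-pow-one k x = sym (trans (*-congˡ (pow-one (n ∸ k))) (*-identityʳ x))

    signed-Q : sumTo n (λ k → sign (n ∸ k) * fromℕ (n C k) * fromℕ (Q n k) * pow (y + 1#) k)
               ≈ binomialForm n matchings y (y + 1#)
    signed-Q =
      trans (sumTo-cong n (λ _ _ → solve 4 (λ s a q p → s :* a :* q :* p := a :* q :* p :* s) refl _ _ _ _))
      (trans (Q-transform n (y + 1#) (- 1#)) (binomialForm-cong n (λ _ _ → refl) y+1-1 refl))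

    unsigned-I : sumTo n (λ k → fromℕ (n C k) * pow y k * fromℕ (I k)) ≈ binomialForm n matchings y (y + 1#)
    unsigned-I =
      trans (sumTo-cong n (λ k _ → trans (solve 3 (λ a p i → a :* p :* i := a :* i :* p) refl _ _ _) (times-pow-one k _)))
            (I-transform n y 1#)

    unsigned-Q : sumTo n (λ k → fromℕ (n C k) * fromℕ (Q n k) * pow y k) ≈ binomialForm n matchings (y + 1#) y
    unsigned-Q = trans (sumTo-cong n (λ k _ → times-pow-one k _)) (Q-transform n y 1#)

    signed-I : sumTo n (λ k → sign (n ∸ k) * fromℕ (n C k) * pow (y + 1#) k * fromℕ (I k))
               ≈ binomialForm n matchings (y + 1#) y
    signed-I =
      trans (sumTo-cong n (λ _ _ → solve 4 (λ s a p i → s :* a :* p :* i := a :* i :* p :* s) refl _ _ _ _))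
      (trans (I-transform n (y + 1#) (- 1#)) (binomialForm-cong n (λ _ _ → refl) refl y+1-1))

theorem4p2 : ∀ {c ℓ : Level} (R : CommutativeRing c ℓ) (n : ℕ) (y : CommutativeRing.Carrier R) →
    let open CommutativeRing R
        open RingOps R
    in (sumTo n (λ k → sign (n ∸ k) * fromℕ (n C k) * fromℕ (Q n k) * pow (y + 1#) k)
          ≈ sumTo n (λ k → fromℕ (n C k) * pow y k * fromℕ (I k)))
       × (sumTo n (λ k → fromℕ (n C k) * fromℕ (Q n k) * pow y k)
          ≈ sumTo n (λ k → sign (n ∸ k) * fromℕ (n C k) * pow (y + 1#) k * fromℕ (I k)))
       × (sumTo n (λ k → fromℕ (n C k) * fromℕ (Q n k) * pow y k)
          ≈ sumTo ⌊ n /2⌋ (λ k → fromℕ (n C (2 ℕ.* k)) * fromℕ (oddDoubleFactorial k)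
                                  * pow y (n ∸ 2 ℕ.* k) * pow (y + 1#) (2 ℕ.* k)))
-- Both sides of the first identity equal ∑_e C(n,e) pm(e) y^e (y+1)^(n-e); the
-- sums in the second and third equal ∑_e C(n,e) pm(e) (y+1)^e y^(n-e).
theorem4p2 R n y =
  trans signed-Q (sym unsigned-I) ,
  trans unsigned-Q (sym signed-I) ,
  trans unsigned-Q (matchings-evens n (y + 1#) y)
  where
  open CommutativeRing R using (_+_; 1#; trans; sym)
  open ClosedForms R using (matchings-evens; module Sums)
  open Sums n y
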